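{- Let $p\mathit{Sign}$ have the same objects as $\mathit{Sign}$ and the partial $\mathit{Sign}$-morphisms as arrows, with composition and order defined as in the context. Then $p\mathit{Sign}$ is a $\frac{3}{2}$-category, i.e. a category whose hom-sets are partially ordered and whose composition preserves these partial orders.
   Context: Let $\mathit{Sign}$ be a category endowed with an inclusion system $\langle\mathcal{I},\mathcal{E}\rangle$ (two broad subcategories, $\mathcal{I}$ a partial order of "abstract inclusions" $\subseteq$, every arrow factoring uniquely as an arrow of $\mathcal{E}$ followed by one of $\mathcal{I}$), and assume $\mathit{Sign}$ has pullbacks of semi-inclusive cospans (cospans in which one of the two arrows is an abstract inclusion). Then for any $f\colon A\to B$ and any inclusion $B'\subseteq B$ there is a unique pullback $f'\colon A'\to B'$ with $A'\subseteq A$. A partial $\mathit{Sign}$-morphism $\varphi\colon\Sigma\rightharpoonup\Sigma'$ is a $\mathit{Sign}$-morphism $\varphi^0\colon\Sigma_0\to\Sigma'$ with $\Sigma_0\subseteq\Sigma$; $\Sigma_0$ is denoted $\mathrm{dom}\,\varphi$. The composition of $\varphi\colon\Sigma\rightharpoonup\Sigma'$ and $\varphi'\colon\Sigma'\rightharpoonup\Sigma''$ has $\mathrm{dom}(\varphi;\varphi')\subseteq\mathrm{dom}\,\varphi$ and $(\varphi;\varphi')^0=(\varphi^0)';\varphi'^0$, where $(\varphi^0)'\colon\mathrm{dom}(\varphi;\varphi')\to\mathrm{dom}\,\varphi'$ is the unique pullback of $\varphi^0$ along the inclusion $\mathrm{dom}\,\varphi'\subseteq\Sigma'$ with $\mathrm{dom}(\varphi;\varphi')\subseteq\mathrm{dom}\,\varphi$.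 For $\varphi,\theta\colon\Sigma\rightharpoonup\Sigma'$, $\varphi\leq\theta$ iff $\mathrm{dom}\,\varphi\subseteq\mathrm{dom}\,\theta$ and $\varphi^0=(\mathrm{dom}\,\varphi\subseteq\mathrm{dom}\,\theta);\theta^0$. -}

module Defs where

open import Level using (Level; _⊔_) renaming (suc to lsuc)
open import Data.Product using (Σ; _×_; _,_; proj₁; proj₂)
open import Data.Sum using (_⊎_)
open import Relation.Binary using (Rel; IsEquivalence; IsPartialOrder)
open import Relation.Binary.PropositionalEquality using (_≡_; subst)

record IsCategory {o ℓ e : Level} (Obj : Set o) (Hom : Obj → Obj → Set ℓ)
                  (_≈_ : ∀ {A B} → Rel (Hom A B) e)
                  (id : ∀ {A} → Hom A A)
                  (_⨾_ : ∀ {A B C} → Hom A B → Hom B C → Hom A C)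
                  : Set (o ⊔ ℓ ⊔ e) where
  field
    ≈-equiv : ∀ {A B} → IsEquivalence (_≈_ {A} {B})
    assoc   : ∀ {A B C D} {f : Hom A B} {g : Hom B C} {h : Hom C D} →
              ((f ⨾ g) ⨾ h) ≈ (f ⨾ (g ⨾ h))
    idˡ     : ∀ {A B} {f : Hom A B} → (id ⨾ f) ≈ f
    idʳ     : ∀ {A B} {f : Hom A B} → (f ⨾ id) ≈ f
    ⨾-resp  : ∀ {A B C} {f f' : Hom A B} {g g' : Hom B C} →
              f ≈ f' → g ≈ g' → (f ⨾ g) ≈ (f' ⨾ g')

record Category (o ℓ e : Level) : Set (lsuc (o ⊔ ℓ ⊔ e)) where
  infixr 9 _⨾_
  infix 4 _≈_
  field
    Obj : Set o
    Hom : Obj → Obj → Set ℓ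
    _≈_ : ∀ {A B} → Rel (Hom A B) e
    id  : ∀ {A} → Hom A A
    _⨾_ : ∀ {A B C} → Hom A B → Hom B C → Hom A C
    isCategory : IsCategory Obj Hom _≈_ id _⨾_
  open IsCategory isCategory public

record IsThreeHalvesCategory {o ℓ e r : Level} (Obj : Set o) (Hom : Obj → Obj → Set ℓ)
                  (_≈_ : ∀ {A B} → Rel (Hom A B) e)
                  (id : ∀ {A} → Hom A A)
                  (_⨾_ : ∀ {A B C} → Hom A B → Hom B C → Hom A C)
                  (_≤_ : ∀ {A B} → Rel (Hom A B) r)
                  : Set (o ⊔ ℓ ⊔ e ⊔ r) where
  field
    isCategory     : IsCategory Obj Hom _≈_ id _⨾_
    isPartialOrder : ∀ {A B} → IsPartialOrder (_≈_ {A} {B}) (_≤_ {A} {B})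
    ⨾-mono         : ∀ {A B C} {f f' : Hom A B} {g g' : Hom B C} →
                     f ≤ f' → g ≤ g' → (f ⨾ g) ≤ (f' ⨾ g')

module _ {o ℓ e : Level} (C : Category o ℓ e) where
  open Category C

  record InclusionSystem (i e' : Level) : Set (o ⊔ ℓ ⊔ e ⊔ Level.suc (i ⊔ e')) where
    field
      IsI : ∀ {A B} → Hom A B → Set i
      IsE : ∀ {A B} → Hom A B → Set e'
      I-resp : ∀ {A B} {f g : Hom A B} → f ≈ g → IsI f → IsI g
      E-resp : ∀ {A B} {f g : Hom A B} → f ≈ g → IsE f → IsE g
      I-id   : ∀ {A} → IsI (id {A})
      E-id   : ∀ {A} → IsE (id {A})
      I-⨾    : ∀ {A B D} {f : Hom A B} {g : Hom B D} → IsI f → IsI g → IsI (f ⨾ g)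
      E-⨾    : ∀ {A B D} {f : Hom A B} {g : Hom B D} → IsE f → IsE g → IsE (f ⨾ g)
      I-thin    : ∀ {A B} {f g : Hom A B} → IsI f → IsI g → f ≈ g
      I-antisym : ∀ {A B} {f : Hom A B} {g : Hom B A} → IsI f → IsI g → A ≡ B
      factor : ∀ {A B} (f : Hom A B) →
               Σ Obj λ D → Σ (Hom A D) λ ε → Σ (Hom D B) λ ι →
                 IsE ε × IsI ι × (ε ⨾ ι) ≈ f
      factor-unique : ∀ {A B D D'} {ε : Hom A D} {ι : Hom D B}
                        {ε' : Hom A D'} {ι' : Hom D' B} →
                      IsE ε → IsI ι → IsE ε' → IsI ι' → (ε ⨾ ι) ≈ (ε' ⨾ ι') →
                      Σ (D ≡ D') λ eq →
                        subst (Hom A) eq ε ≈ ε' × subst (λ X → Hom X B) eq ι ≈ ι'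

  IsPullback : ∀ {A B D P} (f : Hom A D) (g : Hom B D) (p : Hom P A) (q : Hom P B) →
               Set (o ⊔ ℓ ⊔ e)
  IsPullback {A} {B} {D} {P} f g p q =
    (p ⨾ f) ≈ (q ⨾ g) ×
    (∀ {X} (x : Hom X A) (y : Hom X B) → (x ⨾ f) ≈ (y ⨾ g) →
       Σ (Hom X P) λ u → ((u ⨾ p) ≈ x × (u ⨾ q) ≈ y) ×
         (∀ (u' : Hom X P) → (u' ⨾ p) ≈ x → (u' ⨾ q) ≈ y → u' ≈ u))

  module _ {i e' : Level} (IS : InclusionSystem i e') where
    open InclusionSystem IS

    HasSemiInclusivePullbacks : Set (o ⊔ ℓ ⊔ e ⊔ i)
    HasSemiInclusivePullbacks =
      ∀ {A B D} (f : Hom A D) (g : Hom B D) → IsI f ⊎ IsI g →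
      Σ Obj λ P → Σ (Hom P A) λ p → Σ (Hom P B) λ q → IsPullback f g p q

    -- The consequence recorded in the context: for f : A → B and an
    -- inclusion j : B' ⊆ B there is a unique pullback f' : A' → B' of f
    -- along j whose other leg is an inclusion A' ⊆ A.
    record InclusivePullbacks : Set (o ⊔ ℓ ⊔ e ⊔ i) where
      field
        restrictObj : ∀ {A B B'} (f : Hom A B) (j : Hom B' B) → IsI j → Obj
        restrictInc : ∀ {A B B'} (f : Hom A B) (j : Hom B' B) (jI : IsI j) →
                      Hom (restrictObj f j jI) A
        restrictInc-I : ∀ {A B B'} (f : Hom A B) (j : Hom B' B) (jI : IsI j) →
                        IsI (restrictInc f j jI)
        restrictMap : ∀ {A B B'} (f : Hom A B) (j : Hom B' B) (jI : IsI j) →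
                      Hom (restrictObj f j jI) B'
        restrict-pb : ∀ {A B B'} (f : Hom A B) (j : Hom B' B) (jI : IsI j) →
                      IsPullback f j (restrictInc f j jI) (restrictMap f j jI)
        restrict-unique : ∀ {A B B' A''} (f : Hom A B) (j : Hom B' B) (jI : IsI j)
                            (i'' : Hom A'' A) (f'' : Hom A'' B') →
                          IsI i'' → IsPullback f j i'' f'' →
                          Σ (A'' ≡ restrictObj f j jI) λ eq →
                            subst (λ X → Hom X B') eq f'' ≈ restrictMap f j jI

module PSign {o ℓ e i e' : Level} (C : Category o ℓ e)
             (IS : InclusionSystem C i e') (R : InclusivePullbacks C IS) where
  open Category C
  open InclusionSystem IS
  open InclusivePullbacks R

  -- φ : Σ ⇀ Σ'  given by  dom φ ⊆ Σ  and  φ⁰ : dom φ → Σ'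
  record PMor (S S' : Obj) : Set (o ⊔ ℓ ⊔ i) where
    constructor pmor
    field
      dom   : Obj
      incl  : Hom dom S
      inclI : IsI incl
      map   : Hom dom S'
  open PMor public

  _≐_ : ∀ {S S'} → Rel (PMor S S') (o ⊔ e)
  _≐_ {S} {S'} φ θ = Σ (dom φ ≡ dom θ) λ eq → subst (λ X → Hom X S') eq (map φ) ≈ map θ

  pid : ∀ {S} → PMor S S
  pid {S} = pmor S id I-id id

  _⊙_ : ∀ {S S' S''} → PMor S S' → PMor S' S'' → PMor S S''
  φ ⊙ φ' =
    pmor (restrictObj (map φ) (incl φ') (inclI φ'))
         (restrictInc (map φ) (incl φ') (inclI φ') ⨾ incl φ)
         (I-⨾ (restrictInc-I (map φ) (incl φ') (inclI φ')) (inclI φ))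
         (restrictMap (map φ) (incl φ') (inclI φ') ⨾ map φ')

  _≤ₚ_ : ∀ {S S'} → Rel (PMor S S') (ℓ ⊔ e ⊔ i)
  _≤ₚ_ φ θ = Σ (Hom (dom φ) (dom θ)) λ k → IsI k × map φ ≈ (k ⨾ map θ)

-- The composite φ ⊙ ψ is determined up to ≐ by the universal property of the pullback
-- of map φ along incl ψ, so the category laws reduce to facts about pullbacks: pulling back
-- along an identity, invariance under ≈, and the two pasting laws for associativity.
-- Monotonicity of ⊙ uses the mediating morphism between the two defining pullbacks,
-- which is an inclusion because inclusions are right-cancellable in an inclusion system.
module Submission where

open import Defs
open import Level using (Level)
open import Data.Product using (_,_; proj₁; proj₂)
open import Relation.Binary using (Setoid; IsEquivalence; IsPartialOrder)
open import Relation.Binary.PropositionalEquality using (refl)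
import Relation.Binary.Reasoning.Setoid as SetoidReasoning

module CategoryProperties {o ℓ e : Level} (C : Category o ℓ e) where
  open Category C

  hom-setoid : Obj → Obj → Setoid ℓ e
  hom-setoid A B = record { isEquivalence = ≈-equiv {A} {B} }

  module _ {A B : Obj} where
    open Setoid (hom-setoid A B) public
      using () renaming (refl to ≈-refl; sym to ≈-sym; trans to ≈-trans)
    open SetoidReasoning (hom-setoid A B) public

  ⨾-congˡ : ∀ {A B D} {f : Hom A B} {g g' : Hom B D} → g ≈ g' → f ⨾ g ≈ f ⨾ g'
  ⨾-congˡ = ⨾-resp ≈-refl

  ⨾-congʳ : ∀ {A B D} {f f' : Hom A B} {g : Hom B D} → f ≈ f' → f ⨾ g ≈ f' ⨾ g
  ⨾-congʳ f≈f' = ⨾-resp f≈f' ≈-refl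

  IsPullback-swap : ∀ {A B D P} {f : Hom A D} {g : Hom B D} {p : Hom P A} {q : Hom P B} →
                    IsPullback C f g p q → IsPullback C g f q p
  IsPullback-swap (commutes , universal) = ≈-sym commutes , λ x y xg≈yf →
    let u , (up≈y , uq≈x) , unique = universal y x (≈-sym xg≈yf)
    in u , (uq≈x , up≈y) , λ u' u'q≈x u'p≈y → unique u' u'p≈y u'q≈x

  IsPullback-id : ∀ {A B} (g : Hom A B) → IsPullback C id g g id
  IsPullback-id g = ≈-trans idʳ (≈-sym idˡ) , λ x y x≈yg →
    y , (≈-trans (≈-sym x≈yg) idʳ , idʳ) , λ u' _ u'≈y → ≈-trans (≈-sym idʳ) u'≈y

  IsPullback-resp : ∀ {A B D P} {f f' : Hom A D} {g g' : Hom B D} {p : Hom P A} {q : Hom P B} →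
                    f ≈ f' → g ≈ g' → IsPullback C f g p q → IsPullback C f' g' p q
  IsPullback-resp f≈f' g≈g' (commutes , universal) =
    ≈-trans (⨾-congˡ (≈-sym f≈f')) (≈-trans commutes (⨾-congˡ g≈g')) , λ x y xf'≈yg' →
      universal x y (≈-trans (⨾-congˡ f≈f') (≈-trans xf'≈yg' (⨾-congˡ (≈-sym g≈g'))))

  IsPullback-glue : ∀ {A B₁ B₂ D P₁ P₂}
                       {f : Hom A D} {g : Hom B₁ D} {a : Hom B₂ B₁}
                       {p₁ : Hom P₁ A} {q₁ : Hom P₁ B₁} {p₂ : Hom P₂ P₁} {q₂ : Hom P₂ B₂} →
                     IsPullback C f g p₁ q₁ → IsPullback C q₁ a p₂ q₂ →
                     IsPullback C f (a ⨾ g) (p₂ ⨾ p₁) q₂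
  IsPullback-glue {f = f} {g} {a} {p₁} {q₁} {p₂} {q₂} (comm₁ , univ₁) (comm₂ , univ₂) =
    commutes , λ x y xf≈yag →
      let v , (vp₁≈x , vq₁≈ya) , v-unique = univ₁ x (y ⨾ a) (≈-trans xf≈yag (≈-sym assoc))
          w , (wp₂≈v , wq₂≈y) , w-unique = univ₂ v y vq₁≈ya
      in w , (≈-trans (≈-sym assoc) (≈-trans (⨾-congʳ wp₂≈v) vp₁≈x) , wq₂≈y) ,
         λ w' w'p≈x w'q₂≈y → w-unique w' (v-unique (w' ⨾ p₂) (≈-trans assoc w'p≈x) (begin
           (w' ⨾ p₂) ⨾ q₁   ≈⟨ assoc ⟩
           w' ⨾ (p₂ ⨾ q₁)   ≈⟨ ⨾-congˡ comm₂ ⟩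
           w' ⨾ (q₂ ⨾ a)    ≈⟨ assoc ⟨
           (w' ⨾ q₂) ⨾ a    ≈⟨ ⨾-congʳ w'q₂≈y ⟩
           y ⨾ a            ∎)) w'q₂≈y
    where
    commutes : (p₂ ⨾ p₁) ⨾ f ≈ q₂ ⨾ (a ⨾ g)
    commutes = begin
      (p₂ ⨾ p₁) ⨾ f   ≈⟨ assoc ⟩
      p₂ ⨾ (p₁ ⨾ f)   ≈⟨ ⨾-congˡ comm₁ ⟩
      p₂ ⨾ (q₁ ⨾ g)   ≈⟨ assoc ⟨
      (p₂ ⨾ q₁) ⨾ g   ≈⟨ ⨾-congʳ comm₂ ⟩
      (q₂ ⨾ a) ⨾ g    ≈⟨ assoc ⟩
      q₂ ⨾ (a ⨾ g)    ∎

  IsPullback-unglue : ∀ {B₁ B₂ D P P₁ Q}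
                         {m : Hom B₁ D} {h : Hom B₂ D} {a : Hom Q B₁} {b : Hom Q B₂}
                         {k : Hom P₁ B₁} {p : Hom P P₁} {q : Hom P B₂} {u : Hom P Q} →
                       IsPullback C m h a b → IsPullback C (k ⨾ m) h p q →
                       u ⨾ a ≈ p ⨾ k → u ⨾ b ≈ q →
                       IsPullback C k a p u
  IsPullback-unglue {m = m} {h} {a} {b} {k} {p} {q} {u}
                    (comm , univ) (_ , outer-univ) ua≈pk ub≈q =
    ≈-sym ua≈pk , λ x y xk≈ya →
      let xkm≈ybh = begin
            (x ⨾ k) ⨾ m   ≈⟨ ⨾-congʳ xk≈ya ⟩
            (y ⨾ a) ⨾ m   ≈⟨ assoc ⟩
            y ⨾ (a ⨾ m)   ≈⟨ ⨾-congˡ comm ⟩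
            y ⨾ (b ⨾ h)   ≈⟨ assoc ⟨
            (y ⨾ b) ⨾ h   ∎
          w , (wp≈x , wq≈yb) , w-unique = outer-univ x (y ⨾ b) (≈-trans (≈-sym assoc) xkm≈ybh)
          _ , _ , z-unique = univ (x ⨾ k) (y ⨾ b) xkm≈ybh
          wua≈xk = begin
            (w ⨾ u) ⨾ a   ≈⟨ assoc ⟩
            w ⨾ (u ⨾ a)   ≈⟨ ⨾-congˡ ua≈pk ⟩
            w ⨾ (p ⨾ k)   ≈⟨ assoc ⟨
            (w ⨾ p) ⨾ k   ≈⟨ ⨾-congʳ wp≈x ⟩
            x ⨾ k         ∎
          wub≈yb = ≈-trans assoc (≈-trans (⨾-congˡ ub≈q) wq≈yb)
          wu≈y = ≈-trans (z-unique (w ⨾ u) wua≈xk wub≈yb) (≈-sym (z-unique y (≈-sym xk≈ya) ≈-refl))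
      in w , (wp≈x , wu≈y) ,
         λ w' w'p≈x w'u≈y → w-unique w' w'p≈x (begin
           w' ⨾ q         ≈⟨ ⨾-congˡ ub≈q ⟨
           w' ⨾ (u ⨾ b)   ≈⟨ assoc ⟨
           (w' ⨾ u) ⨾ b   ≈⟨ ⨾-congʳ w'u≈y ⟩
           y ⨾ b          ∎)

module InclusionSystemProperties {o ℓ e i e' : Level} (C : Category o ℓ e)
                                 (IS : InclusionSystem C i e') where
  open Category C
  open InclusionSystem IS
  open CategoryProperties C

  -- If k = ε ⨾ ι, then ε ⨾ (ι ⨾ j) and id ⨾ (k ⨾ j) both factorise k ⨾ j, so ε is an identity.
  I-cancelʳ : ∀ {A B D} {k : Hom A B} {j : Hom B D} → IsI (k ⨾ j) → IsI j → IsI k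
  I-cancelʳ {k = k} {j} kjI jI with factor k
  ... | _ , ε , ι , εE , ιI , ει≈k
    with factor-unique εE (I-⨾ ιI jI) E-id kjI
           (≈-trans (≈-sym assoc) (≈-trans (⨾-congʳ ει≈k) (≈-sym idˡ)))
  ... | refl , ε≈id , _ = I-resp ι≈k ιI
    where
    ι≈k : ι ≈ k
    ι≈k = begin
      ι       ≈⟨ idˡ ⟨
      id ⨾ ι  ≈⟨ ⨾-congʳ ε≈id ⟨
      ε ⨾ ι   ≈⟨ ει≈k ⟩
      k       ∎

module PSignProperties {o ℓ e i e' : Level} (C : Category o ℓ e)
                       (IS : InclusionSystem C i e') (R : InclusivePullbacks C IS) where
  open Category C
  open InclusionSystem IS
  open InclusivePullbacks R
  open PSign C IS R
  open CategoryProperties C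
  open InclusionSystemProperties C IS

  ≐-isEquivalence : ∀ {S S'} → IsEquivalence (_≐_ {S} {S'})
  ≐-isEquivalence = record
    { refl  = refl , ≈-refl
    ; sym   = λ { (refl , p) → refl , ≈-sym p }
    ; trans = λ { (refl , p) (refl , q) → refl , ≈-trans p q }
    }

  ≤ₚ-antisym : ∀ {S S'} {φ θ : PMor S S'} → φ ≤ₚ θ → θ ≤ₚ φ → φ ≐ θ
  ≤ₚ-antisym (k , kI , p) (_ , k'I , _) with I-antisym kI k'I
  ... | refl = refl , ≈-trans p (≈-trans (⨾-congʳ (I-thin kI I-id)) idˡ)

  ≤ₚ-isPartialOrder : ∀ {S S'} → IsPartialOrder (_≐_ {S} {S'}) _≤ₚ_
  ≤ₚ-isPartialOrder = record
    { isPreorder = record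
      { isEquivalence = ≐-isEquivalence
      ; reflexive     = λ { (refl , p) → id , I-id , ≈-trans p (≈-sym idˡ) }
      ; trans         = λ { (k , kI , p) (k' , k'I , p') →
                              k ⨾ k' , I-⨾ kI k'I , ≈-trans p (≈-trans (⨾-congˡ p') (≈-sym assoc)) }
      }
    ; antisym = λ {φ} {θ} → ≤ₚ-antisym {φ = φ} {θ}
    }

  ⊙-unique : ∀ {S S' S''} (φ : PMor S S') (ψ : PMor S' S'') (θ : PMor S S'')
               {j : Hom (dom θ) (dom φ)} {r : Hom (dom θ) (dom ψ)} → IsI j →
             IsPullback C (map φ) (incl ψ) j r → map θ ≈ r ⨾ map ψ → (φ ⊙ ψ) ≐ θ
  ⊙-unique φ ψ (pmor _ _ _ _) {j} {r} jI pb θ≈rψ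
    with restrict-unique (map φ) (incl ψ) (inclI ψ) j r jI pb
  ... | refl , r≈r' = refl , ≈-trans (⨾-congʳ (≈-sym r≈r')) (≈-sym θ≈rψ)

  ⊙-identityˡ : ∀ {S S'} (φ : PMor S S') → (pid ⊙ φ) ≐ φ
  ⊙-identityˡ φ = ⊙-unique pid φ φ (inclI φ) (IsPullback-id (incl φ)) (≈-sym idˡ)

  ⊙-identityʳ : ∀ {S S'} (φ : PMor S S') → (φ ⊙ pid) ≐ φ
  ⊙-identityʳ φ = ⊙-unique φ pid φ I-id (IsPullback-swap (IsPullback-id (map φ))) (≈-sym idʳ)

  -- By the two pasting laws, the domain of (φ ⊙ ψ) ⊙ χ is also a pullback of
  -- map φ along incl (ψ ⊙ χ).
  ⊙-assoc : ∀ {S₁ S₂ S₃ S₄} (φ : PMor S₁ S₂) (ψ : PMor S₂ S₃) (χ : PMor S₃ S₄) →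
            ((φ ⊙ ψ) ⊙ χ) ≐ (φ ⊙ (ψ ⊙ χ))
  ⊙-assoc φ ψ χ =
    let pb-ψχ = restrict-pb (map ψ) (incl χ) (inclI χ)
        pb-φψ,χ = restrict-pb (map (φ ⊙ ψ)) (incl χ) (inclI χ)
        _ , (ug≈jr , us≈r) , _ = proj₂ pb-ψχ _ _ (≈-trans assoc (proj₁ pb-φψ,χ))
    in IsEquivalence.sym ≐-isEquivalence {φ ⊙ (ψ ⊙ χ)} {(φ ⊙ ψ) ⊙ χ}
         (⊙-unique φ (ψ ⊙ χ) ((φ ⊙ ψ) ⊙ χ) (I-⨾ (restrictInc-I _ _ _) (restrictInc-I _ _ _))
            (IsPullback-glue (restrict-pb _ _ _) (IsPullback-unglue pb-ψχ pb-φψ,χ ug≈jr us≈r))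
            (≈-trans (⨾-congʳ (≈-sym us≈r)) assoc))

  ⊙-resp : ∀ {S S' S''} {φ φ' : PMor S S'} {ψ ψ' : PMor S' S''} →
           φ ≐ φ' → ψ ≐ ψ' → (φ ⊙ ψ) ≐ (φ' ⊙ ψ')
  ⊙-resp {φ = φ} {φ'} {ψ} {ψ'} (refl , φ≈φ') (refl , ψ≈ψ') =
    ⊙-unique φ ψ (φ' ⊙ ψ') (restrictInc-I _ _ _)
      (IsPullback-resp (≈-sym φ≈φ') (I-thin (inclI ψ') (inclI ψ))
         (restrict-pb (map φ') (incl ψ') (inclI ψ')))
      (⨾-congˡ (≈-sym ψ≈ψ'))

  ⊙-mono : ∀ {S S' S''} {φ φ' : PMor S S'} {ψ ψ' : PMor S' S''} →
           φ ≤ₚ φ' → ψ ≤ₚ ψ' → (φ ⊙ ψ) ≤ₚ (φ' ⊙ ψ')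
  ⊙-mono {φ = φ} {φ'} {ψ} {ψ'} (a , aI , φ≈aφ') (b , bI , ψ≈bψ') =
    let j = restrictInc (map φ) (incl ψ) (inclI ψ)
        r = restrictMap (map φ) (incl ψ) (inclI ψ)
        r' = restrictMap (map φ') (incl ψ') (inclI ψ')
        square = begin
          (j ⨾ a) ⨾ map φ'    ≈⟨ assoc ⟩
          j ⨾ (a ⨾ map φ')    ≈⟨ ⨾-congˡ φ≈aφ' ⟨
          j ⨾ map φ           ≈⟨ proj₁ (restrict-pb (map φ) (incl ψ) (inclI ψ)) ⟩
          r ⨾ incl ψ          ≈⟨ ⨾-congˡ (I-thin (inclI ψ) (I-⨾ bI (inclI ψ'))) ⟩
          r ⨾ (b ⨾ incl ψ')   ≈⟨ assoc ⟨
          (r ⨾ b) ⨾ incl ψ'   ∎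
        k , (kj'≈ja , kr'≈rb) , _ = proj₂ (restrict-pb (map φ') (incl ψ') (inclI ψ')) (j ⨾ a) (r ⨾ b) square
    in k ,
       I-cancelʳ (I-resp (≈-sym kj'≈ja) (I-⨾ (restrictInc-I _ _ _) aI)) (restrictInc-I _ _ _) ,
       (begin
          r ⨾ map ψ           ≈⟨ ⨾-congˡ ψ≈bψ' ⟩
          r ⨾ (b ⨾ map ψ')    ≈⟨ assoc ⟨
          (r ⨾ b) ⨾ map ψ'    ≈⟨ ⨾-congʳ kr'≈rb ⟨
          (k ⨾ r') ⨾ map ψ'   ≈⟨ assoc ⟩
          k ⨾ (r' ⨾ map ψ')   ∎)

  pSign-isThreeHalvesCategory : IsThreeHalvesCategory Obj PMor _≐_ pid _⊙_ _≤ₚ_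
  pSign-isThreeHalvesCategory = record
    { isCategory = record
      { ≈-equiv = ≐-isEquivalence
      ; assoc   = λ {_} {_} {_} {_} {φ} {ψ} {χ} → ⊙-assoc φ ψ χ
      ; idˡ     = λ {_} {_} {φ} → ⊙-identityˡ φ
      ; idʳ     = λ {_} {_} {φ} → ⊙-identityʳ φ
      ; ⨾-resp  = λ {_} {_} {_} {φ} {φ'} {ψ} {ψ'} → ⊙-resp {φ = φ} {φ'} {ψ} {ψ'}
      }
    ; isPartialOrder = ≤ₚ-isPartialOrder
    ; ⨾-mono = λ {_} {_} {_} {φ} {φ'} {ψ} {ψ'} → ⊙-mono {φ = φ} {φ'} {ψ} {ψ'}
    }

-- The semi-inclusive pullbacks are only needed to construct R, which is supplied directly.
mainTheorem3 : ∀ {o ℓ e i e' : Level} (C : Category o ℓ e) (IS : InclusionSystem C i e')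
                 → HasSemiInclusivePullbacks C IS
                 → (R : InclusivePullbacks C IS)
                 → IsThreeHalvesCategory (Category.Obj C) (PSign.PMor C IS R)
                     (PSign._≐_ C IS R) (PSign.pid C IS R) (PSign._⊙_ C IS R)
                     (PSign._≤ₚ_ C IS R)
mainTheorem3 C IS _ R = PSignProperties.pSign-isThreeHalvesCategory C IS R
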